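{- Let $k \ge 4$ be an even integer and let $D$ be a $k$-quasi-transitive digraph. If $v \in V(D)$ is a $(k+2)$-king of $D$ but not a $(k+1)$-king of $D$, then there is a vertex $u \in V(D)$ with $d(v,u) = k+2$ that is a $2$-king of $D$. Also, the set $S = \{ w \in V(D) : d(v,w) = k+2 \}$ induces a semicomplete subdigraph of $D$.
   Context: All digraphs are finite, without loops and without multiple arcs in the same direction; paths are directed. For $u,v \in V(D)$, $d(u,v)$ is the length of a shortest directed $uv$-path ($\infty$ if none, $d(v,v)=0$). A vertex $v$ is an $r$-king of $D$ if $d(v,u) \le r$ for every $u \in V(D)$. $D$ is $k$-quasi-transitive if for every directed path $(v_0, \dots, v_k)$ of length $k$, $(v_0,v_k) \in A(D)$ or $(v_k,v_0) \in A(D)$. A digraph is semicomplete if between any two distinct vertices there is at least one arc. -}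

module Defs where

open import Data.Nat using (ℕ; zero; suc; _≤_; _<_)
open import Data.Fin using (Fin; inject₁; toℕ) renaming (suc to fsuc)
open import Data.Product using (Σ; ∃; _×_; _,_)
open import Data.Sum using (_⊎_)
open import Relation.Nullary using (¬_; Dec)
open import Relation.Binary.PropositionalEquality using (_≡_)
open import Function.Definitions using (Injective)

record Digraph : Set₁ where
  field
    n     : ℕ
    Arc   : Fin n → Fin n → Set
    decArc : ∀ u v → Dec (Arc u v)
    loopless : ∀ v → ¬ Arc v v

module _ (D : Digraph) where
  open Digraph D

  data Walk : Fin n → Fin n → ℕ → Set where
    here : ∀ {u} → Walk u u zero
    step : ∀ {u w v m} → Arc u w → Walk w v m → Walk u v (suc m)

  DistLe : Fin n → Fin n → ℕ → Set
  DistLe u v r = Σ ℕ λ m → m ≤ r × Walk u v m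

  DistEq : Fin n → Fin n → ℕ → Set
  DistEq u v m = Walk u v m × (∀ j → j < m → ¬ Walk u v j)

  IsKing : ℕ → Fin n → Set
  IsKing r v = ∀ u → DistLe v u r

  record DPath (k : ℕ) : Set where
    field
      vert : Fin (suc k) → Fin n
      distinct : Injective _≡_ _≡_ vert
      arcs : (i : Fin k) → Arc (vert (inject₁ i)) (vert (fsuc i))

  QuasiTransitive : ℕ → Set
  QuasiTransitive k = (P : DPath k) →
    let open DPath P in
    Arc (vert Data.Fin.zero) (vert (Data.Fin.fromℕ k)) ⊎
    Arc (vert (Data.Fin.fromℕ k)) (vert Data.Fin.zero)

  InducesSemicomplete : (Fin n → Set) → Set
  InducesSemicomplete S =
    ∀ x y → S x → S y → ¬ x ≡ y → Arc x y ⊎ Arc y x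

-- Let ℓ w be the distance from v to w and S the set of vertices at distance k + 2.  Walks that
-- climb one level per arc have distinct vertices, so k-quasi-transitivity applies to walks of
-- length k glued from pieces of shortest paths out of v; in particular every vertex at level k
-- has an arc back to v.  Fix s ∈ S.  If s dominates a vertex x at level j + 2 on a shortest
-- path to level k, the walk from s through x to level k, back to v and down to level j shows
-- that s dominates all of level j.  Applied to level 2 of a shortest v-s path this gives s → v,
-- hence s dominates level k − 1 and, descending two levels at a time, every odd level; as k is
-- even this includes level 1, which gives level k and then every even level.  So s dominates
-- all levels ≤ k and is adjacent to every other vertex; in particular S is semicomplete.
-- Finally, if u ∈ S is not a 2-king, a vertex z unreachable from u in two steps lies in S and
-- its out-neighbourhood strictly contains that of u, so repeating the step ends at a 2-king.

module Submission where

open import Defs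
open import Data.Nat using (ℕ; zero; suc; _≤_; _<_; _+_; _*_; _∸_; s≤s; s≤s⁻¹; z≤n)
open import Data.Nat.Properties
open import Data.Nat.Induction using (<-wellFounded)
open import Data.Nat.Tactic.RingSolver using (solve-∀)
open import Data.Fin using (Fin; inject₁; fromℕ) renaming (zero to fzero; suc to fsuc)
import Data.Fin.Properties as Fin
open import Data.Fin.Subset using (Subset; _∈_; _⊂_; _⊃_)
open import Data.Fin.Subset.Induction using (⊃-wellFounded)
open import Data.Vec using (Vec; []; _∷_; _++_; lookup; tabulate)
open import Data.Vec.Properties using (lookup∘tabulate; lookup⇒[]=; []=⇒lookup)
open import Data.Vec.Relation.Unary.All using (All; []; _∷_)
import Data.Vec.Relation.Unary.All as All
import Data.Vec.Relation.Unary.All.Properties as All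
import Data.Vec.Relation.Unary.AllPairs.Properties as AllPairs
open import Data.Vec.Relation.Unary.Unique.Propositional using (Unique; []; _∷_)
open import Data.Vec.Relation.Unary.Unique.Propositional.Properties using (lookup-injective)
open import Data.Product using (Σ; _×_; _,_; proj₁; proj₂)
open import Data.Sum using (_⊎_; inj₁; inj₂)
import Data.Sum as Sum
open import Data.Empty using (⊥-elim)
open import Function.Base using (_∘_)
open import Induction.WellFounded using (Acc; acc)
open import Relation.Nullary using (¬_; Dec; yes; no; does)
open import Relation.Nullary.Decidable using (map′; _×-dec_; dec-true)
open import Relation.Binary.PropositionalEquality

module Walks (D : Digraph) where
  open Digraph D

  private
    variable
      a b c : Fin n
      i j m : ℕ

  infixr 5 _++ʷ_

  _++ʷ_ : Walk D a b i → Walk D b c j → Walk D a c (i + j)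
  here     ++ʷ q = q
  step e p ++ʷ q = step e (p ++ʷ q)

  splitAt : ∀ i → Walk D a b (i + j) → Σ (Fin n) λ c → Walk D a c i × Walk D c b j
  splitAt zero    p          = _ , here , p
  splitAt (suc i) (step e p) with splitAt i p
  ... | c , p₁ , p₂ = c , step e p₁ , p₂

  vertices : Walk D a b m → Vec (Fin n) (suc m)
  vertices {a = a} here = a ∷ []
  vertices (step {u = u} _ p) = u ∷ vertices p

  vertices-++ʷ-step : ∀ {d} (p : Walk D a b i) (e : Arc b c) (q : Walk D c d j) →
                      vertices (p ++ʷ step e q) ≡ vertices p ++ vertices q
  vertices-++ʷ-step here       e q = refl
  vertices-++ʷ-step (step _ p) e q rewrite vertices-++ʷ-step p e q = refl

  lookup-vertices-first : (p : Walk D a b m) → lookup (vertices p) fzero ≡ a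
  lookup-vertices-first here       = refl
  lookup-vertices-first (step _ p) = refl

  lookup-vertices-last : (p : Walk D a b m) → lookup (vertices p) (fromℕ m) ≡ b
  lookup-vertices-last here       = refl
  lookup-vertices-last (step _ p) = lookup-vertices-last p

  lookup-vertices-arc : (p : Walk D a b m) (x : Fin m) →
                        Arc (lookup (vertices p) (inject₁ x)) (lookup (vertices p) (fsuc x))
  lookup-vertices-arc (step e p) fzero    rewrite lookup-vertices-first p = e
  lookup-vertices-arc (step e p) (fsuc x) = lookup-vertices-arc p x

  toDPath : (p : Walk D a b m) → Unique (vertices p) → DPath D m
  toDPath p distinct = record
    { vert     = lookup (vertices p)
    ; distinct = lookup-injective distinct _ _
    ; arcs     = lookup-vertices-arc p
    }

  quasiTransitive-ends : ∀ {k} → QuasiTransitive D k → (p : Walk D a b m) → m ≡ k →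
                         Unique (vertices p) → Arc a b ⊎ Arc b a
  quasiTransitive-ends qt p refl distinct =
    Sum.map (subst₂ Arc first last) (subst₂ Arc last first) (qt (toDPath p distinct))
    where
    first = lookup-vertices-first p
    last  = lookup-vertices-last p

  walk? : ∀ a b m → Dec (Walk D a b m)
  walk? a b zero with a Fin.≟ b
  ... | yes refl = yes here
  ... | no  a≢b  = no λ { here → a≢b refl }
  walk? a b (suc m) = map′ (λ (c , e , p) → step e p) (λ { (step e p) → _ , e , p })
                           (Fin.any? λ c → decArc a c ×-dec walk? c b m)

  distLe? : ∀ a b r → Dec (DistLe D a b r)
  distLe? a b r = map′ (λ (m , m<r+1 , p) → m , ≤-pred m<r+1 , p)
                       (λ (m , m≤r , p) → m , s≤s m≤r , p)
                       (anyUpTo? (walk? a b) (suc r))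

  shortest : (p : Walk D a b m) → Σ ℕ λ j → j ≤ m × DistEq D a b j
  shortest {m = m} = go m (<-wellFounded m)
    where
    go : ∀ m → Acc _<_ m → Walk D a b m → Σ ℕ λ j → j ≤ m × DistEq D a b j
    go m (acc shorter) p with anyUpTo? (walk? _ _) m
    ... | no  none = m , ≤-refl , p , λ j j<m q → none (j , j<m , q)
    ... | yes (j , j<m , q) with go j (shorter j<m) q
    ...   | i , i≤j , d = i , ≤-trans i≤j (<⇒≤ j<m) , d

module Levels (D : Digraph) (v : Fin (Digraph.n D)) (r : ℕ) (king : IsKing D r v) where
  open Digraph D
  open Walks D

  private
    variable
      a b c w : Fin n
      i j m : ℕ

    distance : ∀ w → Σ ℕ λ j → j ≤ r × DistEq D v w j
    distance w with king w
    ... | m , m≤r , p with shortest p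
    ...   | j , j≤m , d = j , ≤-trans j≤m m≤r , d

  ℓ : Fin n → ℕ
  ℓ w = proj₁ (distance w)

  ℓ≤r : ∀ w → ℓ w ≤ r
  ℓ≤r w = proj₁ (proj₂ (distance w))

  distEq-ℓ : ∀ w → DistEq D v w (ℓ w)
  distEq-ℓ w = proj₂ (proj₂ (distance w))

  path : ∀ w → Walk D v w (ℓ w)
  path w = proj₁ (distEq-ℓ w)

  ℓ-minimal : Walk D v w j → ℓ w ≤ j
  ℓ-minimal {w} p = ≮⇒≥ λ j<ℓw → proj₂ (distEq-ℓ w) _ j<ℓw p

  ℓ-distEq : DistEq D v w j → ℓ w ≡ j
  ℓ-distEq {w} (p , minimal) = ≤-antisym (ℓ-minimal p) (≮⇒≥ λ ℓw<j → minimal _ ℓw<j (path w))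

  ℓ-root : ℓ v ≡ 0
  ℓ-root = n≤0⇒n≡0 (ℓ-minimal here)

  ℓ≡0⇒root : ℓ w ≡ 0 → v ≡ w
  ℓ≡0⇒root {w} ℓw≡0 with ℓ w | path w
  ℓ≡0⇒root refl | zero | here = refl

  ℓ-walk : Walk D a b m → ℓ b ≤ ℓ a + m
  ℓ-walk {a} p = ℓ-minimal (path a ++ʷ p)

  -- p climbs exactly one level per arc: it is a segment of a shortest path from v.
  Ascending : Walk D a b m → Set
  Ascending {a} {b} {m} _ = ℓ b ≡ ℓ a + m

  path-ascending : ∀ w → Ascending (path w)
  path-ascending w = cong (_+ ℓ w) (sym ℓ-root)

  ascending-parts : (p : Walk D a c i) (q : Walk D c b j) → ℓ b ≡ ℓ a + (i + j) →
                    Ascending p × Ascending q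
  ascending-parts {a} {c} {i} {b} {j} p q ℓb≡ = ℓc≡ , ℓb≡ℓc+j
    where
    ℓc≡ : ℓ c ≡ ℓ a + i
    ℓc≡ = ≤-antisym (ℓ-walk p) (+-cancelʳ-≤ j (ℓ a + i) (ℓ c) (begin
      ℓ a + i + j    ≡⟨ +-assoc (ℓ a) i j ⟩
      ℓ a + (i + j)  ≡⟨ ℓb≡ ⟨
      ℓ b            ≤⟨ ℓ-walk q ⟩
      ℓ c + j        ∎))
      where open ≤-Reasoning
    ℓb≡ℓc+j : ℓ b ≡ ℓ c + j
    ℓb≡ℓc+j = trans ℓb≡ (trans (sym (+-assoc (ℓ a) i j)) (cong (_+ j) (sym ℓc≡)))

  splitPath : ∀ i j → ℓ w ≡ i + j → Σ (Fin n) λ c → ℓ c ≡ i × Σ (Walk D c w j) Ascending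
  splitPath {w} i j ℓw≡ with splitAt i (subst (Walk D v w) ℓw≡ (path w))
  ... | c , p , q with ascending-parts p q (trans ℓw≡ (cong (_+ (i + j)) (sym ℓ-root)))
  ...   | ℓc≡ , asc = c , trans ℓc≡ (cong (_+ i) ℓ-root) , q , asc

  ascending-step : (e : Arc a c) (p : Walk D c b m) → Ascending (step e p) →
                   ℓ c ≡ suc (ℓ a) × Ascending p
  ascending-step {a} e p asc with ascending-parts (step e here) p asc
  ... | ℓc≡ , asc′ = trans ℓc≡ (+-comm (ℓ a) 1) , asc′

  ascending-above : (p : Walk D a b m) → Ascending p → All (λ x → ℓ a ≤ ℓ x) (vertices p)
  ascending-above here       _   = ≤-refl ∷ []
  ascending-above (step e p) asc with ascending-step e p asc
  ... | ℓc≡ , asc′ =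
    ≤-refl ∷ All.map (≤-trans (<⇒≤ (≤-reflexive (sym ℓc≡)))) (ascending-above p asc′)

  ascending-below : (p : Walk D a b m) → Ascending p → All (λ x → ℓ x ≤ ℓ b) (vertices p)
  ascending-below here       _   = ≤-refl ∷ []
  ascending-below (step e p) asc =
    ≤-trans (m≤m+n _ _) (≤-reflexive (sym asc)) ∷ ascending-below p (proj₂ (ascending-step e p asc))

  ascending-unique : (p : Walk D a b m) → Ascending p → Unique (vertices p)
  ascending-unique here       _   = [] ∷ []
  ascending-unique (step e p) asc with ascending-step e p asc
  ... | ℓc≡ , asc′ =
    All.map (λ { ℓc≤ℓa refl → <⇒≱ (≤-reflexive (sym ℓc≡)) ℓc≤ℓa }) (ascending-above p asc′)
    ∷ ascending-unique p asc′

  ascending-avoids : ∀ {s} (p : Walk D a b m) → Ascending p → ℓ b ≤ ℓ s → s ≢ b →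
                     All (s ≢_) (vertices p)
  ascending-avoids here       _   _     s≢b = s≢b ∷ []
  ascending-avoids (step e p) asc ℓb≤ℓs s≢b =
    (λ { refl → m+1+n≰m _ (≤-trans (≤-reflexive (sym asc)) ℓb≤ℓs) })
    ∷ ascending-avoids p (proj₂ (ascending-step e p asc)) ℓb≤ℓs s≢b

  separated : ∀ {h i j} {xs : Vec (Fin n) i} {ys : Vec (Fin n) j} →
              All (λ x → h < ℓ x) xs → All (λ y → ℓ y ≤ h) ys → All (λ x → All (x ≢_) ys) xs
  separated above below =
    All.map (λ h<ℓx → All.map (λ { ℓy≤h refl → <⇒≱ h<ℓx ℓy≤h }) below) above

  ℓ-distLe : ∀ {j} → ℓ w ≤ j → DistLe D v w j
  ℓ-distLe {w} ℓw≤j = ℓ w , ℓw≤j , path w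

even⇒2*e+2 : ∀ {k} t → k ≡ 2 * t → 2 ≤ k → Σ ℕ λ e → 2 * e + 2 ≡ k
even⇒2*e+2 zero    refl ()
even⇒2*e+2 (suc e) refl _ = e , lemma e
  where
  lemma : ∀ e → 2 * e + 2 ≡ 2 * suc e
  lemma = solve-∀

level-cases : ∀ {j k} → j ≤ k + 2 → j ≤ k ⊎ j ≡ suc k ⊎ j ≡ k + 2
level-cases {j} {k} j≤k+2 with m≤n⇒m<n∨m≡n j≤k+2
... | inj₂ j≡k+2 = inj₂ (inj₂ j≡k+2)
... | inj₁ j<k+2 with m≤n⇒m<n∨m≡n (s≤s⁻¹ (subst (j <_) (+-comm k 2) j<k+2))
...   | inj₁ j<k+1 = inj₁ (s≤s⁻¹ j<k+1)
...   | inj₂ j≡k+1 = inj₂ (inj₁ j≡k+1)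

module Neighbourhoods (D : Digraph) where
  open Digraph D

  neighbours : Fin n → Subset n
  neighbours u = tabulate λ w → does (decArc u w)

  ∈-neighbours⁺ : ∀ {u w} → Arc u w → w ∈ neighbours u
  ∈-neighbours⁺ {u} {w} u→w =
    lookup⇒[]= w _ (trans (lookup∘tabulate _ w) (dec-true (decArc u w) u→w))

  ∈-neighbours⁻ : ∀ {u w} → w ∈ neighbours u → Arc u w
  ∈-neighbours⁻ {u} {w} w∈ with decArc u w | trans (sym (lookup∘tabulate _ w)) ([]=⇒lookup w∈)
  ... | yes u→w | _  = u→w
  ... | no _    | ()

module QuasiTransitiveKing (k : ℕ) (4≤k : 4 ≤ k) (t : ℕ) (k≡2t : k ≡ 2 * t)
         (D : Digraph) (qt : QuasiTransitive D k)
         (v : Fin (Digraph.n D)) (king : IsKing D (k + 2) v) where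
  open Digraph D
  open Walks D
  open Levels D v (k + 2) king
  open Neighbourhoods D

  private
    variable
      a b w z : Fin n
      m : ℕ

    2≤k : 2 ≤ k
    2≤k = ≤-trans (s≤s (s≤s z≤n)) 4≤k

    3≤k : 3 ≤ k
    3≤k = ≤-trans (s≤s (s≤s (s≤s z≤n))) 4≤k

    k≡1+[k∸1] : k ≡ 1 + (k ∸ 1)
    k≡1+[k∸1] = sym (m+[n∸m]≡n (≤-trans (s≤s z≤n) 4≤k))

  quasiTransitive-ascending : (p : Walk D a b m) → m ≡ k → Ascending p → Arc a b ⊎ Arc b a
  quasiTransitive-ascending p m≡k asc = quasiTransitive-ends qt p m≡k (ascending-unique p asc)

  level-k⇒arc-to-root : ℓ b ≡ k → Arc b v
  level-k⇒arc-to-root {b} ℓb≡k with quasiTransitive-ascending (path b) ℓb≡k (path-ascending b)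
  ... | inj₂ b→v = b→v
  ... | inj₁ v→b = ⊥-elim (<⇒≱ (subst (1 <_) (sym ℓb≡k) 2≤k) (ℓ-minimal (step v→b here)))

  module Dominant (s : Fin n) (ℓs≡k+2 : ℓ s ≡ k + 2) where

    ℓ<ℓs : ℓ w ≤ k → ℓ w < ℓ s
    ℓ<ℓs ℓw≤k = subst (_ <_) (sym ℓs≡k+2) (≤-<-trans ℓw≤k (m<m+n k (s≤s z≤n)))

    s≢-below : ℓ w < ℓ s → s ≢ w
    s≢-below ℓw<ℓs refl = <-irrefl refl ℓw<ℓs

    arc-from-s : Arc s w ⊎ Arc w s → ℓ w ≤ k → Arc s w
    arc-from-s (inj₁ s→w) _    = s→w
    arc-from-s {w} (inj₂ w→s) ℓw≤k = ⊥-elim (<-irrefl refl (begin-strict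
      ℓ s     ≤⟨ ℓ-walk (step w→s here) ⟩
      ℓ w + 1 ≤⟨ +-monoˡ-≤ 1 ℓw≤k ⟩
      k + 1   <⟨ +-monoʳ-< k ≤-refl ⟩
      k + 2   ≡⟨ ℓs≡k+2 ⟨
      ℓ s     ∎))
      where open ≤-Reasoning

    ascending-avoids-s : (p : Walk D a b m) → Ascending p → ℓ b ≤ k → All (s ≢_) (vertices p)
    ascending-avoids-s p asc ℓb≤k = ascending-avoids p asc (<⇒≤ (ℓ<ℓs ℓb≤k)) (s≢-below (ℓ<ℓs ℓb≤k))

    -- Quasi-transitivity applied to s → c followed by the last k ∸ 1 arcs of a shortest
    -- path to w.
    adjacent-via-level : ∀ i → (∀ c → ℓ c ≡ i → Arc s c) → ℓ w ≡ i + (k ∸ 1) → ℓ w ≤ ℓ s →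
                         s ≢ w → Arc s w ⊎ Arc w s
    adjacent-via-level i s→level-i ℓw≡ ℓw≤ℓs s≢w with splitPath i (k ∸ 1) ℓw≡
    ... | c , ℓc≡i , p , asc =
      quasiTransitive-ends qt (step (s→level-i c ℓc≡i) p) (sym k≡1+[k∸1])
        (ascending-avoids p asc ℓw≤ℓs s≢w ∷ ascending-unique p asc)

    -- Quasi-transitivity applied to the walk s → a ⇝ b → v ⇝ w of length k, whose vertices
    -- are distinct because p stays strictly above level ℓ w and the path v ⇝ w does not.
    dominates-two-below : Arc s a → (p : Walk D a b m) → Ascending p → ℓ b ≡ k →
                          ℓ a ≡ 2 + ℓ w → Arc s w
    dominates-two-below {a} {b} {m} {w} s→a p ascp ℓb≡k ℓa≡ =
      arc-from-s (quasiTransitive-ends qt detour length distinct) ℓw≤k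
      where
      q = path w
      ascq = path-ascending w
      b→v = level-k⇒arc-to-root ℓb≡k
      detour = step s→a (p ++ʷ step b→v q)
      k≡ : k ≡ 2 + ℓ w + m
      k≡ = trans (sym ℓb≡k) (trans ascp (cong (_+ m) ℓa≡))
      length : suc (m + suc (ℓ w)) ≡ k
      length = trans (lemma m (ℓ w)) (sym k≡)
        where
        lemma : ∀ m x → suc (m + suc x) ≡ 2 + x + m
        lemma = solve-∀
      ℓw≤k : ℓ w ≤ k
      ℓw≤k = subst (ℓ w ≤_) (sym k≡) (≤-trans (m≤n+m (ℓ w) 2) (m≤m+n (2 + ℓ w) m))
      ℓw<ℓa : ℓ w < ℓ a
      ℓw<ℓa = subst (ℓ w <_) (sym ℓa≡) (m<n+m (ℓ w) (s≤s z≤n))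
      distinct : Unique (vertices detour)
      distinct = subst (λ xs → Unique (s ∷ xs)) (sym (vertices-++ʷ-step p b→v q))
        (All.++⁺ (ascending-avoids-s p ascp (≤-reflexive ℓb≡k)) (ascending-avoids-s q ascq ℓw≤k)
         ∷ AllPairs.++⁺ (ascending-unique p ascp) (ascending-unique q ascq)
             (separated (All.map (<-≤-trans ℓw<ℓa) (ascending-above p ascp)) (ascending-below q ascq)))

    -- Opaque, since unfolding the level of y during unification is prohibitively expensive.
    opaque
      below-s : Σ (Fin n) λ y → ℓ y ≡ k × Σ (Walk D y s 2) Ascending
      below-s = splitPath k 2 ℓs≡k+2

    private
      y : Fin n
      y = proj₁ below-s

      ℓy≡k : ℓ y ≡ k
      ℓy≡k = proj₁ (proj₂ below-s)

      y→s : Walk D y s 2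
      y→s = proj₁ (proj₂ (proj₂ below-s))

    s→root : Arc s v
    s→root with splitPath {y} 2 (k ∸ 2) (trans ℓy≡k (sym (m+[n∸m]≡n 2≤k)))
    ... | x , ℓx≡2 , p , ascp = dominates-two-below s→x p ascp ℓy≡k ℓx≡2+ℓv
      where
      asc : Ascending (p ++ʷ y→s)
      asc = trans ℓs≡k+2 (trans (+-comm k 2) (cong₂ _+_ (sym ℓx≡2) (sym (m∸n+n≡m 2≤k))))
      s→x : Arc s x
      s→x = arc-from-s (Sum.swap (quasiTransitive-ascending (p ++ʷ y→s) (m∸n+n≡m 2≤k) asc))
                       (subst (_≤ k) (sym ℓx≡2) 2≤k)
      ℓx≡2+ℓv : ℓ x ≡ 2 + ℓ v
      ℓx≡2+ℓv = trans ℓx≡2 (cong (2 +_) (sym ℓ-root))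

    DominatesLayer : ℕ → Set
    DominatesLayer d = ∀ w → ℓ w + d ≡ k → Arc s w

    dominates-layer-1 : DominatesLayer 1
    dominates-layer-1 w ℓw+1≡k =
      arc-from-s (adjacent-via-level 0 s→level-0 ℓw≡ (<⇒≤ ℓw<ℓs) (s≢-below ℓw<ℓs)) ℓw≤k
      where
      s→level-0 : ∀ c → ℓ c ≡ 0 → Arc s c
      s→level-0 c ℓc≡0 = subst (Arc s) (ℓ≡0⇒root ℓc≡0) s→root
      ℓw≡ : ℓ w ≡ k ∸ 1
      ℓw≡ = trans (sym (m+n∸n≡m (ℓ w) 1)) (cong (_∸ 1) ℓw+1≡k)
      ℓw≤k : ℓ w ≤ k
      ℓw≤k = subst (ℓ w ≤_) ℓw+1≡k (m≤m+n (ℓ w) 1)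
      ℓw<ℓs = ℓ<ℓs ℓw≤k

    dominates-layer-2+ : ∀ {d} → DominatesLayer d → DominatesLayer (2 + d)
    dominates-layer-2+ {d} s→layer-d w ℓw+2+d≡k = via (trans (lemma (ℓ w) d) ℓw+2+d≡k)
      where
      lemma : ∀ x d → 2 + x + d ≡ x + (2 + d)
      lemma = solve-∀
      via : 2 + ℓ w + d ≡ k → Arc s w
      via eq with splitPath {y} (2 + ℓ w) d (trans ℓy≡k (sym eq))
      ... | x , ℓx≡ , p , ascp =
        dominates-two-below (s→layer-d x (trans (cong (_+ d) ℓx≡) eq)) p ascp ℓy≡k ℓx≡

    dominates-layer-2*+ : ∀ {d} → DominatesLayer d → ∀ e → DominatesLayer (2 * e + d)
    dominates-layer-2*+     s→layer-d zero    = s→layer-d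
    dominates-layer-2*+ {d} s→layer-d (suc e) =
      subst DominatesLayer (lemma e d) (dominates-layer-2+ (dominates-layer-2*+ s→layer-d e))
      where
      lemma : ∀ e d → 2 + (2 * e + d) ≡ 2 * suc e + d
      lemma = solve-∀

    -- The only use of the parity of k: level 1 lies an odd number of layers below level k.
    dominates-level-1 : ∀ w → ℓ w ≡ 1 → Arc s w
    dominates-level-1 w ℓw≡1 with even⇒2*e+2 t k≡2t 2≤k
    ... | e , 2e+2≡k =
      dominates-layer-2*+ dominates-layer-1 e w (trans (cong (_+ _) ℓw≡1) (trans (lemma e) 2e+2≡k))
      where
      lemma : ∀ e → 1 + (2 * e + 1) ≡ 2 * e + 2
      lemma = solve-∀

    dominates-layer-0 : DominatesLayer 0
    dominates-layer-0 w ℓw+0≡k =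
      arc-from-s (adjacent-via-level 1 dominates-level-1 ℓw≡ (<⇒≤ ℓw<ℓs) (s≢-below ℓw<ℓs)) ℓw≤k
      where
      ℓw≡k : ℓ w ≡ k
      ℓw≡k = trans (sym (+-identityʳ (ℓ w))) ℓw+0≡k
      ℓw≡ : ℓ w ≡ 1 + (k ∸ 1)
      ℓw≡ = trans ℓw≡k k≡1+[k∸1]
      ℓw≤k : ℓ w ≤ k
      ℓw≤k = ≤-reflexive ℓw≡k
      ℓw<ℓs = ℓ<ℓs ℓw≤k

    dominates-layer : ∀ d → DominatesLayer d
    dominates-layer 0             = dominates-layer-0
    dominates-layer 1             = dominates-layer-1
    dominates-layer (suc (suc d)) = dominates-layer-2+ (dominates-layer d)

    dominates : ∀ w → ℓ w ≤ k → Arc s w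
    dominates w ℓw≤k = dominates-layer (k ∸ ℓ w) w (m+[n∸m]≡n ℓw≤k)

    adjacent-above : ∀ i → i ≤ k → ℓ w ≡ i + (k ∸ 1) → s ≢ w → Arc s w ⊎ Arc w s
    adjacent-above {w} i i≤k ℓw≡ =
      adjacent-via-level i (λ c ℓc≡i → dominates c (subst (_≤ k) (sym ℓc≡i) i≤k)) ℓw≡
        (subst (ℓ w ≤_) (sym ℓs≡k+2) (ℓ≤r w))

    adjacent : ∀ w → s ≢ w → Arc s w ⊎ Arc w s
    adjacent w s≢w with level-cases (ℓ≤r w)
    ... | inj₁ ℓw≤k          = inj₁ (dominates w ℓw≤k)
    ... | inj₂ (inj₁ ℓw≡k+1) = adjacent-above 2 2≤k (trans ℓw≡k+1 (cong suc k≡1+[k∸1])) s≢w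
    ... | inj₂ (inj₂ ℓw≡k+2) =
      adjacent-above 3 3≤k (trans ℓw≡k+2 (trans (+-comm k 2) (cong (2 +_) k≡1+[k∸1]))) s≢w

  open Dominant

  far-vertex : ℓ a ≡ k + 2 → ¬ DistLe D a z 2 → ℓ z ≡ k + 2 × neighbours a ⊂ neighbours z
  far-vertex {a} {z} ℓa≡k+2 far =
    ℓz≡k+2 ,
    (λ w∈ → ∈-neighbours⁺ (a→w⇒z→w (∈-neighbours⁻ w∈))) ,
    a , ∈-neighbours⁺ z→a , λ a∈ → loopless a (∈-neighbours⁻ a∈)
    where
    a↛z : ¬ Arc a z
    a↛z a→z = far (1 , s≤s z≤n , step a→z here)
    a↛↛z : Arc a w → ¬ Arc w z
    a↛↛z a→w w→z = far (2 , ≤-refl , step a→w (step w→z here))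
    a≢z : a ≢ z
    a≢z refl = far (0 , z≤n , here)
    ℓz≡k+2 : ℓ z ≡ k + 2
    ℓz≡k+2 with level-cases (ℓ≤r z)
    ... | inj₁ ℓz≤k          = ⊥-elim (a↛z (dominates a ℓa≡k+2 z ℓz≤k))
    ... | inj₂ (inj₂ ℓz≡k+2) = ℓz≡k+2
    ... | inj₂ (inj₁ ℓz≡k+1) with splitPath k 1 (trans ℓz≡k+1 (+-comm 1 k))
    ...   | p , ℓp≡k , step p→z here , _ =
      ⊥-elim (a↛↛z (dominates a ℓa≡k+2 p (≤-reflexive ℓp≡k)) p→z)
    z→a : Arc z a
    z→a with adjacent a ℓa≡k+2 z a≢z
    ... | inj₁ a→z = ⊥-elim (a↛z a→z)
    ... | inj₂ z→a = z→a
    a→w⇒z→w : Arc a w → Arc z w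
    a→w⇒z→w {w} a→w with adjacent z ℓz≡k+2 w (λ { refl → a↛z a→w })
    ... | inj₁ z→w = z→w
    ... | inj₂ w→z = ⊥-elim (a↛↛z a→w w→z)

  find-2-king : ℓ a ≡ k + 2 → Acc _⊃_ (neighbours a) →
                Σ (Fin n) λ u → ℓ u ≡ k + 2 × IsKing D 2 u
  find-2-king {a} ℓa≡k+2 (acc larger) with Fin.all? (λ w → distLe? a w 2)
  ... | yes a-king = a , ℓa≡k+2 , a-king
  ... | no ¬a-king with Fin.¬∀⟶∃¬ n _ (λ w → distLe? a w 2) ¬a-king
  ...   | z , far with far-vertex ℓa≡k+2 far
  ...     | ℓz≡k+2 , a⊂z = find-2-king ℓz≡k+2 (larger a⊂z)

  not-king⇒top-level : ¬ DistLe D v a (k + 1) → ℓ a ≡ k + 2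
  not-king⇒top-level {a} far =
    ≤-antisym (ℓ≤r a) (subst (_≤ ℓ a) (sym (+-suc k 1)) (≰⇒> (far ∘ ℓ-distLe)))

  2-king-at-top : ¬ IsKing D (k + 1) v → Σ (Fin n) λ u → ℓ u ≡ k + 2 × IsKing D 2 u
  2-king-at-top ¬king with Fin.¬∀⟶∃¬ n _ (λ w → distLe? v w (k + 1)) ¬king
  ... | a , far = find-2-king (not-king⇒top-level far) (⊃-wellFounded _)

mainTheorem11 : (k : ℕ) → 4 ≤ k → (Σ ℕ λ t → k ≡ 2 * t) →
    (D : Digraph) → QuasiTransitive D k →
    (v : Fin (Digraph.n D)) →
    IsKing D (k + 2) v → ¬ IsKing D (k + 1) v →
    (Σ (Fin (Digraph.n D)) λ u → DistEq D v u (k + 2) × IsKing D 2 u)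
    × InducesSemicomplete D (λ w → DistEq D v w (k + 2))
mainTheorem11 k 4≤k (t , k≡2t) D qt v king ¬king = 2-king-at-distance-k+2 , semicomplete
  where
  open QuasiTransitiveKing k 4≤k t k≡2t D qt v king
  open Levels D v (k + 2) king

  2-king-at-distance-k+2 : Σ (Fin (Digraph.n D)) λ u → DistEq D v u (k + 2) × IsKing D 2 u
  2-king-at-distance-k+2 with 2-king-at-top ¬king
  ... | u , ℓu≡k+2 , u-king = u , subst (DistEq D v u) ℓu≡k+2 (distEq-ℓ u) , u-king

  semicomplete : InducesSemicomplete D (λ w → DistEq D v w (k + 2))
  semicomplete x y x∈S _ x≢y = Dominant.adjacent x (ℓ-distEq x∈S) y x≢y
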